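{- Let $A,B$ be two words of length $\ell$ with the same auto-correlation, i.e. $\mathrm{Cor}(A,A)=\mathrm{Cor}(B,B)$. Define $\phi:\mathcal{E}(A,B)\to\mathcal{E}(A,B)$ as follows: if $Y=C_1{}^{m_1}C_2{}^{m_2}\cdots C_{k-1}{}^{m_{k-1}}C_k$ with $C_i\in\{A,B\}$, set $$\phi(Y)=\bar C_k{}^{m_{k-1}}\bar C_{k-1}{}^{m_{k-2}}\cdots \bar C_2{}^{m_1}\bar C_1,$$ where $\bar C_i=A$ if $C_i=B$ and $\bar C_i=B$ if $C_i=A$. Then $\phi$ is well defined (i.e. $m_i\in\mathrm{Cor}(\bar C_{i+1},\bar C_i)$ for each $i$), $\phi(Y)$ does not depend on the decomposition of $Y$ chosen, $\phi$ is an involution, $\phi(Y)$ has the same length as $Y$, and $(N_A(Y),N_B(Y))=(N_B(\phi(Y)),N_A(\phi(Y)))$ for every $Y\in\mathcal{E}(A,B)$.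
   Context: Words are finite sequences over $\{\mathrm{H},\mathrm{T}\}$. For a word $A=(a_1,\ldots,a_\ell)$ and a word $Y=(\varepsilon_1,\ldots,\varepsilon_n)$, $N_A(Y)=|\{\ell\le k\le n:\ (\varepsilon_{k-\ell+1},\ldots,\varepsilon_k)=A\}|$ is the number of (possibly overlapping) occurrences of $A$ in $Y$. For words $C,D$ of length $\ell$, $\mathrm{Cor}(C,D)=\{1\le k\le\ell-1:\ (c_{\ell-k+1},\ldots,c_\ell)=(d_1,\ldots,d_k)\}$. For $m\in\mathrm{Cor}(C,D)$, $C^{m}D$ denotes the word of length $2\ell-m$ that begins with $C$ and ends with $D$ (the last $m$ letters of $C$ coincide with the first $m$ letters of $D$). More generally, for words $C_1,\ldots,C_k$ of length $\ell$ and integers $m_i\in\mathrm{Cor}(C_i,C_{i+1})$ (so $m_i\ge1$), $C_1{}^{m_1}C_2{}^{m_2}\cdots C_{k-1}{}^{m_{k-1}}C_k$ is the word of length $k\ell-\sum_i m_i$ obtained by successively overlapping $C_i$ and $C_{i+1}$ on $m_i$ letters. An overlap of $A$ and $B$ is a word of this form with $k\ge1$ and all $C_i\in\{A,B\}$; $\mathcal{E}(A,B)$ denotes the set of all overlaps of $A$ and $B$. Such a representation of a given overlap need not be unique. -}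

module Defs where

open import Data.Nat using (ℕ; zero; suc; _∸_; _≤_; _<_)
open import Data.List using (List; []; _∷_; _++_; length; take; drop; filter; upTo)
open import Data.List.Properties using (≡-dec)
open import Data.Product using (_×_)
open import Data.Unit using (⊤)
open import Relation.Nullary using (Dec; yes; no)
open import Relation.Binary.PropositionalEquality using (_≡_)

data Letter : Set where
  H T : Letter

_≟L_ : (x y : Letter) → Dec (x ≡ y)
H ≟L H = yes _≡_.refl
H ≟L T = no (λ ())
T ≟L H = no (λ ())
T ≟L T = yes _≡_.refl

Word : Set
Word = List Letter

_≟W_ : (x y : Word) → Dec (x ≡ y)
_≟W_ = ≡-dec _≟L_

-- Occurrence ending at position k (ℓ ≤ k ≤ n) <-> starting at index i = k - ℓ,
-- 0 ≤ i ≤ n - ℓ; for ℓ > n the single index i = 0 never matches.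
N : Word → Word → ℕ
N A Y = length (filter (λ i → take (length A) (drop i Y) ≟W A) (upTo (suc (length Y ∸ length A))))

InCor : Word → Word → ℕ → Set
InCor C D k = (1 ≤ k) × (k < length C) × (drop (length C ∸ k) C ≡ take k D)

data Sym : Set where
  a b : Sym

bar : Sym → Sym
bar a = b
bar b = a

-- A decomposition C_1 ^m_1 C_2 ^m_2 ... ^m_{k-1} C_k  (k ≥ 1), C_i ∈ {A,B}.
data Chain : Set where
  end   : Sym → Chain
  _∷⟨_⟩_ : Sym → ℕ → Chain → Chain

first : Chain → Sym
first (end c)       = c
first (c ∷⟨ m ⟩ r) = c

module _ (A B : Word) where

  sym→word : Sym → Word
  sym→word a = A
  sym→word b = B

  word : Chain → Word
  word (end c)       = sym→word c
  word (c ∷⟨ m ⟩ r) = sym→word c ++ drop m (word r)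

  Valid : Chain → Set
  Valid (end c)       = ⊤
  Valid (c ∷⟨ m ⟩ r) = InCor (sym→word c) (sym→word (first r)) m × Valid r

snocC : Chain → ℕ → Sym → Chain
snocC (end d) m c       = d ∷⟨ m ⟩ end c
snocC (d ∷⟨ m' ⟩ r) m c = d ∷⟨ m' ⟩ snocC r m c

φ : Chain → Chain
φ (end c)       = end (bar c)
φ (c ∷⟨ m ⟩ r) = snocC (φ r) m (bar c)

-- Write an overlap Y = C₁ ^m₁ C₂ ⋯ Cₖ as blocks of length ℓ, consecutive blocks shifted by
-- uᵢ = ℓ ∸ mᵢ. An ℓ-window of Y starting inside Cᵢ lies in Cᵢ ^mᵢ Cᵢ₊₁, and it equals W exactly
-- when W may follow Cᵢ and Cᵢ₊₁ may follow W at the corresponding shifts. Because A and B have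
-- the same autocorrelation, "D may follow C at shift i" is equivalent to "C̄ may follow D̄ at
-- shift i" for C, D ∈ {A, B}. Hence W occurs at position p of Y iff W̄ occurs at position
-- ∣Y∣ ∸ ℓ ∸ p of φ(Y): the occurrence vector of W̄ in φ(Y) is the reversal of that of W in Y.
-- This gives the counts and the lengths; and since an overlap is covered by occurrences of its
-- blocks, it is the only word of its length with its occurrence vectors, which makes φ(Y)
-- independent of the decomposition of Y.
module Submission where

open import Defs
open import Data.Bool using (Bool; true; false; if_then_else_)
open import Data.List using (List; []; _∷_; _++_; _∷ʳ_; length; take; drop; filter; map; reverse; upTo)
open import Data.List.Properties
  using ( ∷-injectiveˡ; ∷-injectiveʳ; ++-assoc; ++-identityʳ; ++-cancelˡ; ∷ʳ-++; length-++; length-++-≤ˡ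
        ; length-++-≤ʳ; length-map; length-upTo; length-take; length-drop; length-reverse; take-all; take-[]
        ; take-take; drop-all; drop-drop; take++drop≡id; map-∘; map-cong-local; map-applyUpTo; map-upTo
        ; upTo-∷ʳ; reverse-++; reverse-map; reverse-injective )
open import Data.List.Relation.Binary.Permutation.Propositional.Properties using (map⁺; ↭-reverse)
open import Data.List.Relation.Unary.All.Properties using (applyUpTo⁺₁)
open import Data.Nat using (ℕ; zero; suc; _+_; _∸_; _⊓_; _≤_; _<_; z≤n; s≤s; _≤?_)
open import Data.Nat.ListAction using (sum)
open import Data.Nat.ListAction.Properties using (sum-↭)
open import Data.Nat.Properties
  using ( suc-injective; ≤-refl; ≤-reflexive; ≤-trans; ≤-pred; n≤1+n; n≮n; <⇒≤; ≰⇒>; m≤m+n; +-identityʳ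
        ; +-monoʳ-≤; m≤n⇒m⊓n≡m; 0∸n≡0; m∸n≤m; ∸-monoˡ-≤; ∸-monoʳ-<; m≤n⇒m∸n≡0; m<n⇒0<n∸m; ∸-+-assoc
        ; +-∸-assoc; m+n∸m≡n; m+[n∸m]≡n; m∸n+n≡m; m∸[m∸n]≡n; ∸-cancelʳ-≡ )
open import Data.Product using (_×_; _,_; proj₁; proj₂; ∃)
open import Data.Product.Algebra using (×-comm)
open import Data.Product.Function.NonDependent.Propositional using (_×-⇔_)
open import Data.Unit using (tt)
open import Function using (_∘_; id)
open import Function.Bundles using (_⇔_; mk⇔; Equivalence)
import Function.Properties.Equivalence as ⇔
open import Function.Related.Propositional using (module EquationalReasoning)
open import Level using (0ℓ)
open import Relation.Binary.PropositionalEquality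
open import Relation.Nullary using (Dec; yes; no; does; contradiction)
open import Relation.Nullary.Decidable using (dec-true; does-⇔)
open import Relation.Unary using (Pred; Decidable)

private variable
  E : Set
  xs ys zs ws : List E

++-injective : length xs ≡ length ys → xs ++ zs ≡ ys ++ ws → xs ≡ ys × zs ≡ ws
++-injective {xs = []}     {ys = []}     _  eq = refl , eq
++-injective {xs = x ∷ xs} {ys = y ∷ ys} ∣∣≡ eq =
  let xs≡ys , zs≡ws = ++-injective (suc-injective ∣∣≡) (∷-injectiveʳ eq)
  in cong₂ _∷_ (∷-injectiveˡ eq) xs≡ys , zs≡ws

drop-++ˡ : ∀ n (xs : List E) ys → n ≤ length xs → drop n (xs ++ ys) ≡ drop n xs ++ ys
drop-++ˡ zero    xs       ys _         = refl
drop-++ˡ (suc n) (x ∷ xs) ys (s≤s n≤) = drop-++ˡ n xs ys n≤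

take-length-++ : ∀ (xs : List E) ys n → take (length xs + n) (xs ++ ys) ≡ xs ++ take n ys
take-length-++ []       ys n = refl
take-length-++ (x ∷ xs) ys n = cong (x ∷_) (take-length-++ xs ys n)

take-++-length : ∀ (xs : List E) ys → take (length xs) (xs ++ ys) ≡ xs
take-++-length xs ys = begin
  take (length xs) (xs ++ ys)     ≡⟨ cong (λ n → take n (xs ++ ys)) (+-identityʳ (length xs)) ⟨
  take (length xs + 0) (xs ++ ys) ≡⟨ take-length-++ xs ys 0 ⟩
  xs ++ []                        ≡⟨ ++-identityʳ xs ⟩
  xs                              ∎
  where open ≡-Reasoning

take-+ : ∀ m n (xs : List E) → take (m + n) xs ≡ take m xs ++ take n (drop m xs)
take-+ zero    n xs       = refl
take-+ (suc m) n []       = sym (take-[] n)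
take-+ (suc m) n (x ∷ xs) = cong (x ∷_) (take-+ m n xs)

take-++-take : ∀ n k (xs ys : List E) → n ≤ k → take n (xs ++ ys) ≡ take n (xs ++ take k ys)
take-++-take zero    k       xs       ys       _        = refl
take-++-take (suc n) (suc k) []       []       _        = refl
take-++-take (suc n) (suc k) []       (y ∷ ys) (s≤s n≤) = cong (y ∷_) (take-++-take n k [] ys n≤)
take-++-take (suc n) k       (x ∷ xs) ys       n<       =
  cong (x ∷_) (take-++-take n k xs ys (≤-trans (n≤1+n n) n<))

length-take-≤ : ∀ n (xs : List E) → n ≤ length xs → length (take n xs) ≡ n
length-take-≤ n xs n≤ = trans (length-take n xs) (m≤n⇒m⊓n≡m n≤)

++-drop-overlap : ∀ u m (xs ys : List E) → drop u xs ≡ take m ys → xs ++ drop m ys ≡ take u xs ++ ys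
++-drop-overlap u m xs ys suffix≡prefix = begin
  xs ++ drop m ys                           ≡⟨ cong (_++ drop m ys) (take++drop≡id u xs) ⟨
  (take u xs ++ drop u xs) ++ drop m ys     ≡⟨ ++-assoc (take u xs) (drop u xs) (drop m ys) ⟩
  take u xs ++ (drop u xs ++ drop m ys)     ≡⟨ cong (λ zs → take u xs ++ (zs ++ drop m ys)) suffix≡prefix ⟩
  take u xs ++ (take m ys ++ drop m ys)     ≡⟨ cong (take u xs ++_) (take++drop≡id m ys) ⟩
  take u xs ++ ys                           ∎
  where open ≡-Reasoning

take-length : ∀ (xs : List E) → take (length xs) xs ≡ xs
take-length xs = take-all (length xs) xs ≤-refl

map-upTo-suc : ∀ (f : ℕ → E) n → map f (upTo (suc n)) ≡ f 0 ∷ map (f ∘ suc) (upTo n)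
map-upTo-suc f n = cong (f 0 ∷_) (trans (map-applyUpTo suc f n) (sym (map-upTo (f ∘ suc) n)))

reverse-upTo-suc : ∀ n → reverse (upTo (suc n)) ≡ map (n ∸_) (upTo (suc n))
reverse-upTo-suc zero    = refl
reverse-upTo-suc (suc n) = begin
  reverse (upTo (suc (suc n)))         ≡⟨ cong reverse (upTo-∷ʳ (suc n)) ⟨
  reverse (upTo (suc n) ∷ʳ suc n)      ≡⟨ reverse-++ (upTo (suc n)) (suc n ∷ []) ⟩
  suc n ∷ reverse (upTo (suc n))       ≡⟨ cong (suc n ∷_) (reverse-upTo-suc n) ⟩
  suc n ∷ map (n ∸_) (upTo (suc n))    ≡⟨ map-upTo-suc (suc n ∸_) (suc n) ⟨
  map (suc n ∸_) (upTo (suc (suc n)))  ∎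
  where open ≡-Reasoning

reverse-map-upTo : ∀ (f g : ℕ → E) n → (∀ i → i ≤ n → f (n ∸ i) ≡ g i) →
                   reverse (map f (upTo (suc n))) ≡ map g (upTo (suc n))
reverse-map-upTo f g n f≡g = begin
  reverse (map f (upTo (suc n)))      ≡⟨ reverse-map f (upTo (suc n)) ⟨
  map f (reverse (upTo (suc n)))      ≡⟨ cong (map f) (reverse-upTo-suc n) ⟩
  map f (map (n ∸_) (upTo (suc n)))   ≡⟨ map-∘ (upTo (suc n)) ⟨
  map (f ∘ (n ∸_)) (upTo (suc n))     ≡⟨ map-cong-local (applyUpTo⁺₁ (λ i → i) (suc n) (λ i<1+n → f≡g _ (≤-pred i<1+n))) ⟩
  map g (upTo (suc n))                ∎
  where open ≡-Reasoning

count : List Bool → ℕ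
count = sum ∘ map (λ b → if b then 1 else 0)

length-filter≡count : ∀ {P : Pred E 0ℓ} (P? : Decidable P) xs → length (filter P? xs) ≡ count (map (does ∘ P?) xs)
length-filter≡count P? []       = refl
length-filter≡count P? (x ∷ xs) with does (P? x)
... | true  = cong suc (length-filter≡count P? xs)
... | false = length-filter≡count P? xs

count-reverse : ∀ bs → count (reverse bs) ≡ count bs
count-reverse bs = sum-↭ (map⁺ _ (↭-reverse bs))

OccursAt : Word → Word → ℕ → Set
OccursAt W Y i = take (length W) (drop i Y) ≡ W

occursAt : Word → Word → ℕ → Bool
occursAt W Y i = does (take (length W) (drop i Y) ≟W W)

-- Defined by recursion on Y, rather than as the map of occurrences-upTo, so that its head is
-- definitionally occursAt W Y 0.
mutual
  occurrences : Word → Word → List Bool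
  occurrences W Y = occursAt W Y 0 ∷ laterOccurrences W Y

  laterOccurrences : Word → Word → List Bool
  laterOccurrences W []      = []
  laterOccurrences W (_ ∷ Y) with length W ≤? length Y
  ... | yes _ = occurrences W Y
  ... | no  _ = []

occurrencesIn : Word → Word → Word → List Bool
occurrencesIn W []      Q = []
occurrencesIn W (p ∷ P) Q = occursAt W (p ∷ P ++ Q) 0 ∷ occurrencesIn W P Q

occurrences-upTo : ∀ W Y → occurrences W Y ≡ map (occursAt W Y) (upTo (suc (length Y ∸ length W)))
occurrences-upTo W [] rewrite 0∸n≡0 (length W) = refl
occurrences-upTo W (y ∷ Y) with length W ≤? length Y
... | yes ∣W∣≤∣Y∣ rewrite +-∸-assoc 1 ∣W∣≤∣Y∣ =
  trans (cong (occursAt W (y ∷ Y) 0 ∷_) (occurrences-upTo W Y))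
        (sym (map-upTo-suc (occursAt W (y ∷ Y)) (suc (length Y ∸ length W))))
... | no  ∣W∣≰∣Y∣ rewrite m≤n⇒m∸n≡0 (≰⇒> ∣W∣≰∣Y∣) = refl

length-occurrences : ∀ W Y → length (occurrences W Y) ≡ suc (length Y ∸ length W)
length-occurrences W Y = begin
  length (occurrences W Y)               ≡⟨ cong length (occurrences-upTo W Y) ⟩
  length (map (occursAt W Y) (upTo n))   ≡⟨ length-map (occursAt W Y) (upTo n) ⟩
  length (upTo n)                        ≡⟨ length-upTo n ⟩
  n                                      ∎
  where
  open ≡-Reasoning
  n : ℕ
  n = suc (length Y ∸ length W)

N≡count-occurrences : ∀ W Y → N W Y ≡ count (occurrences W Y)
N≡count-occurrences W Y =
  trans (length-filter≡count (λ i → take (length W) (drop i Y) ≟W W) (upTo (suc (length Y ∸ length W))))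
        (cong count (sym (occurrences-upTo W Y)))

occurrences-short : ∀ W Y → length Y ≤ length W → occurrences W Y ≡ occursAt W Y 0 ∷ []
occurrences-short W []      _ = refl
occurrences-short W (y ∷ Y) ∣Y∣< with length W ≤? length Y
... | yes ∣W∣≤∣Y∣ = contradiction (≤-trans ∣Y∣< ∣W∣≤∣Y∣) (n≮n _)
... | no  _       = refl

length-occurrencesIn : ∀ W P Q → length (occurrencesIn W P Q) ≡ length P
length-occurrencesIn W []      Q = refl
length-occurrencesIn W (p ∷ P) Q = cong suc (length-occurrencesIn W P Q)

occurrences-++ : ∀ W P Q → length W ≤ length Q →
                 occurrences W (P ++ Q) ≡ occurrencesIn W P (take (length W) Q) ++ occurrences W Q
occurrences-++ W []      Q _ = refl
occurrences-++ W (p ∷ P) Q ∣W∣≤∣Q∣ with length W ≤? length (P ++ Q)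
... | yes _ = cong₂ _∷_ (cong (λ V → does (V ≟W W)) (take-++-take (length W) (length W) (p ∷ P) Q ≤-refl))
                        (occurrences-++ W P Q ∣W∣≤∣Q∣)
... | no ∣W∣≰ = contradiction (≤-trans ∣W∣≤∣Q∣ (length-++-≤ʳ Q {P})) ∣W∣≰

occurrences-++-cancelˡ : ∀ W P P′ {Q Q′} → length P ≡ length P′ → length W ≤ length Q → length W ≤ length Q′ →
                         occurrences W (P ++ Q) ≡ occurrences W (P′ ++ Q′) → occurrences W Q ≡ occurrences W Q′
occurrences-++-cancelˡ W P P′ {Q} {Q′} ∣P∣≡∣P′∣ ∣W∣≤∣Q∣ ∣W∣≤∣Q′∣ same = proj₂ (++-injective
  (trans (length-occurrencesIn W P _) (trans ∣P∣≡∣P′∣ (sym (length-occurrencesIn W P′ _))))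
  (trans (sym (occurrences-++ W P Q ∣W∣≤∣Q∣)) (trans same (occurrences-++ W P′ Q′ ∣W∣≤∣Q′∣))))

occurrences-++-whole : ∀ W P Z → length Z ≡ length W →
                       occurrences W (P ++ Z) ≡ occurrencesIn W P Z ∷ʳ occursAt W Z 0
occurrences-++-whole W P Z ∣Z∣≡∣W∣ = begin
  occurrences W (P ++ Z)
    ≡⟨ occurrences-++ W P Z (≤-reflexive (sym ∣Z∣≡∣W∣)) ⟩
  occurrencesIn W P (take (length W) Z) ++ occurrences W Z
    ≡⟨ cong₂ (λ V bs → occurrencesIn W P V ++ bs) takeZ (occurrences-short W Z (≤-reflexive ∣Z∣≡∣W∣)) ⟩
  occurrencesIn W P Z ∷ʳ occursAt W Z 0
    ∎
  where
  open ≡-Reasoning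
  takeZ : take (length W) Z ≡ Z
  takeZ = take-all (length W) Z (≤-reflexive ∣Z∣≡∣W∣)

occurrences-++-++ : ∀ W P Z Q → length Z ≡ length W →
                    occurrences W (P ++ Z ++ Q) ≡ occurrencesIn W P Z ++ occurrences W (Z ++ Q)
occurrences-++-++ W P Z Q ∣Z∣≡∣W∣ = begin
  occurrences W (P ++ Z ++ Q)
    ≡⟨ occurrences-++ W P (Z ++ Q) (≤-trans (≤-reflexive (sym ∣Z∣≡∣W∣)) (length-++-≤ˡ Z)) ⟩
  occurrencesIn W P (take (length W) (Z ++ Q)) ++ occurrences W (Z ++ Q)
    ≡⟨ cong (λ V → occurrencesIn W P V ++ occurrences W (Z ++ Q)) takeZQ ⟩
  occurrencesIn W P Z ++ occurrences W (Z ++ Q)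
    ∎
  where
  open ≡-Reasoning
  takeZQ : take (length W) (Z ++ Q) ≡ Z
  takeZQ = subst (λ k → take k (Z ++ Q) ≡ Z) ∣Z∣≡∣W∣ (take-++-length Z Q)

occursAt-whole : ∀ W Y → length Y ≡ length W → occursAt W Y 0 ≡ does (Y ≟W W)
occursAt-whole W Y ∣Y∣≡∣W∣ = does-⇔ (mk⇔ (trans (sym takeY)) (trans takeY)) (take (length W) Y ≟W W) (Y ≟W W)
  where
  takeY : take (length W) Y ≡ Y
  takeY = take-all (length W) Y (≤-reflexive ∣Y∣≡∣W∣)

occursAt-comm : ∀ V W → length V ≡ length W → occursAt W V 0 ≡ occursAt V W 0
occursAt-comm V W ∣V∣≡∣W∣ = begin
  occursAt W V 0      ≡⟨ occursAt-whole W V ∣V∣≡∣W∣ ⟩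
  does (V ≟W W)       ≡⟨ does-⇔ (mk⇔ sym sym) (V ≟W W) (W ≟W V) ⟩
  does (W ≟W V)       ≡⟨ occursAt-whole V W (sym ∣V∣≡∣W∣) ⟨
  occursAt V W 0      ∎
  where open ≡-Reasoning

occursAt-self : ∀ W → occursAt W W 0 ≡ true
occursAt-self W = dec-true (take (length W) W ≟W W) (take-length W)

does≡true : ∀ {P : Set} (P? : Dec P) → does P? ≡ true → P
does≡true (yes p) _ = p

bar-involutive : ∀ s → bar (bar s) ≡ s
bar-involutive a = refl
bar-involutive b = refl

last : Chain → Sym
last (end c)       = c
last (_ ∷⟨ _ ⟩ r) = last r

first-snocC : ∀ c m s → first (snocC c m s) ≡ first c
first-snocC (end d)       m s = refl
first-snocC (d ∷⟨ _ ⟩ r) m s = refl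

last-snocC : ∀ c m s → last (snocC c m s) ≡ s
last-snocC (end d)       m s = refl
last-snocC (d ∷⟨ _ ⟩ r) m s = last-snocC r m s

last-φ : ∀ c → last (φ c) ≡ bar (first c)
last-φ (end c)       = refl
last-φ (x ∷⟨ m ⟩ r) = last-snocC (φ r) m (bar x)

φ-snocC : ∀ c m s → φ (snocC c m s) ≡ bar s ∷⟨ m ⟩ φ c
φ-snocC (end d)        m s = refl
φ-snocC (d ∷⟨ m′ ⟩ r) m s = cong (λ c → snocC c m′ (bar d)) (φ-snocC r m s)

φ-involutive : ∀ c → φ (φ c) ≡ c
φ-involutive (end c)       = cong end (bar-involutive c)
φ-involutive (x ∷⟨ m ⟩ r) = begin
  φ (snocC (φ r) m (bar x))      ≡⟨ φ-snocC (φ r) m (bar x) ⟩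
  bar (bar x) ∷⟨ m ⟩ φ (φ r)     ≡⟨ cong₂ (_∷⟨ m ⟩_) (bar-involutive x) (φ-involutive r) ⟩
  x ∷⟨ m ⟩ r                     ∎
  where open ≡-Reasoning

module WordsOfLength (ℓ : ℕ) where

  Shift : ℕ → Word → Word → Set
  Shift i X Y = drop i X ≡ take (ℓ ∸ i) Y

  inCor⇒shift : ∀ {C D m} → length C ≡ ℓ → InCor C D m → m < ℓ × Shift (ℓ ∸ m) C D
  inCor⇒shift {C} {D} {m} refl (_ , m<ℓ , suffix≡prefix) =
    m<ℓ , subst (λ k → drop (ℓ ∸ m) C ≡ take k D) (sym (m∸[m∸n]≡n (<⇒≤ m<ℓ))) suffix≡prefix

  shift⇒inCor : ∀ {C D m} → length C ≡ ℓ → 1 ≤ m → m < ℓ → Shift (ℓ ∸ m) C D → InCor C D m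
  shift⇒inCor {C} {D} {m} refl 1≤m m<ℓ shift =
    1≤m , m<ℓ , subst (λ k → drop (ℓ ∸ m) C ≡ take k D) (m∸[m∸n]≡n (<⇒≤ m<ℓ)) shift

  autocorrelation-shift : ∀ {C D} → length C ≡ ℓ → length D ≡ ℓ →
                          (∀ k → InCor C C k → InCor D D k) → ∀ i → Shift i C C → Shift i D D
  autocorrelation-shift {D = D} _ refl _ zero _ = sym (take-length D)
  autocorrelation-shift {C} {D} ∣C∣ refl corCD (suc i) shiftC with ℓ ≤? suc i
  ... | yes ℓ≤i = trans (drop-all (suc i) D ℓ≤i) (sym (cong (λ k → take k D) (m≤n⇒m∸n≡0 ℓ≤i)))
  ... | no  ℓ≰i = subst (λ j → Shift j D D) ℓ∸k≡i (proj₂ (inCor⇒shift refl (corCD k corC)))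
    where
    i<ℓ : suc i < ℓ
    i<ℓ = ≰⇒> ℓ≰i
    k : ℕ
    k = ℓ ∸ suc i
    ℓ∸k≡i : ℓ ∸ k ≡ suc i
    ℓ∸k≡i = m∸[m∸n]≡n (<⇒≤ i<ℓ)
    corC : InCor C C k
    corC = shift⇒inCor ∣C∣ (m<n⇒0<n∸m i<ℓ) (∸-monoʳ-< (s≤s z≤n) (<⇒≤ i<ℓ))
             (subst (λ j → Shift j C C) (sym ℓ∸k≡i) shiftC)

  -- An ℓ-window starting inside the first block of C ^m D (with u = ℓ ∸ m the shift between
  -- the blocks) overlaps C on ℓ ∸ d letters and D on m + d letters.
  occursAt-window : ∀ {C D W m d} → length C ≡ ℓ → length D ≡ ℓ → length W ≡ ℓ →
                    m ≤ ℓ → Shift (ℓ ∸ m) C D → d ≤ ℓ ∸ m →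
                    OccursAt W (C ++ drop m D) d ⇔ (Shift d C W × Shift ((ℓ ∸ m) ∸ d) W D)
  occursAt-window {C} {D} {W} {m} {d} ∣C∣ ∣D∣ refl m≤ℓ shiftCD d≤u = mk⇔ to from
    where
    u : ℕ
    u = ℓ ∸ m
    D′ : Word
    D′ = drop m D
    d≤ℓ : d ≤ ℓ
    d≤ℓ = ≤-trans d≤u (m∸n≤m ℓ m)
    ∣dropC∣ : length (drop d C) ≡ ℓ ∸ d
    ∣dropC∣ = trans (length-drop d C) (cong (_∸ d) ∣C∣)
    ∣takeW∣ : length (take (ℓ ∸ d) W) ≡ ℓ ∸ d
    ∣takeW∣ = length-take-≤ (ℓ ∸ d) W (m∸n≤m ℓ d)

    window : take ℓ (drop d (C ++ D′)) ≡ drop d C ++ take d D′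
    window = begin
      take ℓ (drop d (C ++ D′))
        ≡⟨ cong (take ℓ) (drop-++ˡ d C D′ (≤-trans d≤ℓ (≤-reflexive (sym ∣C∣)))) ⟩
      take ℓ (drop d C ++ D′)
        ≡⟨ cong (λ k → take k (drop d C ++ D′)) (trans (cong (_+ d) ∣dropC∣) (m∸n+n≡m d≤ℓ)) ⟨
      take (length (drop d C) + d) (drop d C ++ D′)
        ≡⟨ take-length-++ (drop d C) D′ d ⟩
      drop d C ++ take d D′
        ∎
      where open ≡-Reasoning

    dropW : Shift d C W → drop (u ∸ d) W ≡ drop u C ++ drop (ℓ ∸ d) W
    dropW shiftCW = begin
      drop (u ∸ d) W
        ≡⟨ cong (drop (u ∸ d)) (take++drop≡id (ℓ ∸ d) W) ⟨
      drop (u ∸ d) (take (ℓ ∸ d) W ++ drop (ℓ ∸ d) W)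
        ≡⟨ drop-++ˡ (u ∸ d) _ _ (≤-trans (∸-monoˡ-≤ d (m∸n≤m ℓ m)) (≤-reflexive (sym ∣takeW∣))) ⟩
      drop (u ∸ d) (take (ℓ ∸ d) W) ++ drop (ℓ ∸ d) W
        ≡⟨ cong (λ V → drop (u ∸ d) V ++ drop (ℓ ∸ d) W) shiftCW ⟨
      drop (u ∸ d) (drop d C) ++ drop (ℓ ∸ d) W
        ≡⟨ cong (_++ drop (ℓ ∸ d) W) (drop-drop d (u ∸ d) C) ⟩
      drop (d + (u ∸ d)) C ++ drop (ℓ ∸ d) W
        ≡⟨ cong (λ k → drop k C ++ drop (ℓ ∸ d) W) (m+[n∸m]≡n d≤u) ⟩
      drop u C ++ drop (ℓ ∸ d) W
        ∎
      where open ≡-Reasoning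

    takeD : take (ℓ ∸ (u ∸ d)) D ≡ drop u C ++ take d D′
    takeD = begin
      take (ℓ ∸ (u ∸ d)) D         ≡⟨ cong (λ k → take k D) ℓ∸[u∸d]≡m+d ⟩
      take (m + d) D               ≡⟨ take-+ m d D ⟩
      take m D ++ take d D′        ≡⟨ cong (λ k → take k D ++ take d D′) (m∸[m∸n]≡n m≤ℓ) ⟨
      take (ℓ ∸ u) D ++ take d D′  ≡⟨ cong (_++ take d D′) shiftCD ⟨
      drop u C ++ take d D′        ∎
      where
      open ≡-Reasoning
      m+d≤ℓ : m + d ≤ ℓ
      m+d≤ℓ = ≤-trans (+-monoʳ-≤ m d≤u) (≤-reflexive (m+[n∸m]≡n m≤ℓ))
      ℓ∸[u∸d]≡m+d : ℓ ∸ (u ∸ d) ≡ m + d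
      ℓ∸[u∸d]≡m+d = trans (cong (ℓ ∸_) (∸-+-assoc ℓ m d)) (m∸[m∸n]≡n m+d≤ℓ)

    to : OccursAt W (C ++ D′) d → Shift d C W × Shift (u ∸ d) W D
    to occurs =
      let shiftCW , tail≡ = ++-injective (trans ∣dropC∣ (sym ∣takeW∣))
                              (trans (sym window) (trans occurs (sym (take++drop≡id (ℓ ∸ d) W))))
      in shiftCW , trans (dropW shiftCW) (trans (cong (drop u C ++_) (sym tail≡)) (sym takeD))

    from : Shift d C W × Shift (u ∸ d) W D → OccursAt W (C ++ D′) d
    from (shiftCW , shiftWD) =
      let tail≡ = ++-cancelˡ (drop u C) (drop (ℓ ∸ d) W) (take d D′) (trans (sym (dropW shiftCW)) (trans shiftWD takeD))
      in trans window (trans (cong₂ _++_ shiftCW (sym tail≡)) (take++drop≡id (ℓ ∸ d) W))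

  module Overlaps (A B : Word) (∣A∣ : length A ≡ ℓ) (∣B∣ : length B ≡ ℓ) where

    ⟪_⟫ : Sym → Word
    ⟪_⟫ = sym→word A B

    ⟦_⟧ : Chain → Word
    ⟦_⟧ = word A B

    length-⟪⟫ : ∀ s → length ⟪ s ⟫ ≡ ℓ
    length-⟪⟫ a = ∣A∣
    length-⟪⟫ b = ∣B∣

    same-length : ∀ s t → length ⟪ s ⟫ ≡ length ⟪ t ⟫
    same-length s t = trans (length-⟪⟫ s) (sym (length-⟪⟫ t))

    take-⟦⟧ : ∀ c → take ℓ ⟦ c ⟧ ≡ ⟪ first c ⟫
    take-⟦⟧ (end x)       = take-all ℓ ⟪ x ⟫ (≤-reflexive (length-⟪⟫ x))
    take-⟦⟧ (x ∷⟨ m ⟩ r) = subst (λ k → take k ⟦ x ∷⟨ m ⟩ r ⟧ ≡ ⟪ x ⟫) (length-⟪⟫ x) (take-++-length ⟪ x ⟫ _)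

    ℓ≤length-⟦⟧ : ∀ c → ℓ ≤ length ⟦ c ⟧
    ℓ≤length-⟦⟧ (end x)       = ≤-reflexive (sym (length-⟪⟫ x))
    ℓ≤length-⟦⟧ (x ∷⟨ m ⟩ r) = ≤-trans (≤-reflexive (sym (length-⟪⟫ x))) (length-++-≤ˡ ⟪ x ⟫)

    ++-overlap : ∀ x z m Y → InCor ⟪ x ⟫ ⟪ z ⟫ m → take ℓ Y ≡ ⟪ z ⟫ → ⟪ x ⟫ ++ drop m Y ≡ take (ℓ ∸ m) ⟪ x ⟫ ++ Y
    ++-overlap x z m Y cor takeY = ++-drop-overlap (ℓ ∸ m) m ⟪ x ⟫ Y (begin
      drop (ℓ ∸ m) ⟪ x ⟫           ≡⟨ proj₂ (inCor⇒shift (length-⟪⟫ x) cor) ⟩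
      take (ℓ ∸ (ℓ ∸ m)) ⟪ z ⟫     ≡⟨ cong (λ k → take k ⟪ z ⟫) (m∸[m∸n]≡n m≤ℓ) ⟩
      take m ⟪ z ⟫                 ≡⟨ cong (take m) takeY ⟨
      take m (take ℓ Y)            ≡⟨ take-take m ℓ Y ⟩
      take (m ⊓ ℓ) Y               ≡⟨ cong (λ k → take k Y) (m≤n⇒m⊓n≡m m≤ℓ) ⟩
      take m Y                     ∎)
      where
      open ≡-Reasoning
      m≤ℓ : m ≤ ℓ
      m≤ℓ = <⇒≤ (proj₁ (inCor⇒shift (length-⟪⟫ x) cor))

    ⟦⟧-∷ : ∀ x m r → Valid A B (x ∷⟨ m ⟩ r) → ⟦ x ∷⟨ m ⟩ r ⟧ ≡ take (ℓ ∸ m) ⟪ x ⟫ ++ ⟦ r ⟧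
    ⟦⟧-∷ x m r (cor , _) = ++-overlap x (first r) m ⟦ r ⟧ cor (take-⟦⟧ r)

    ⟦⟧-snocC : ∀ c m s → Valid A B c → ⟦ snocC c m s ⟧ ≡ ⟦ c ⟧ ++ drop m ⟪ s ⟫
    ⟦⟧-snocC (end x)        m s _           = refl
    ⟦⟧-snocC (x ∷⟨ m′ ⟩ r) m s (cor , valid) = begin
      ⟪ x ⟫ ++ drop m′ ⟦ snocC r m s ⟧             ≡⟨ cong (λ V → ⟪ x ⟫ ++ drop m′ V) (⟦⟧-snocC r m s valid) ⟩
      ⟪ x ⟫ ++ drop m′ (⟦ r ⟧ ++ drop m ⟪ s ⟫)     ≡⟨ cong (⟪ x ⟫ ++_) (drop-++ˡ m′ ⟦ r ⟧ _ m′≤∣r∣) ⟩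
      ⟪ x ⟫ ++ (drop m′ ⟦ r ⟧ ++ drop m ⟪ s ⟫)     ≡⟨ ++-assoc ⟪ x ⟫ (drop m′ ⟦ r ⟧) (drop m ⟪ s ⟫) ⟨
      (⟪ x ⟫ ++ drop m′ ⟦ r ⟧) ++ drop m ⟪ s ⟫     ∎
      where
      open ≡-Reasoning
      m′≤∣r∣ : m′ ≤ length ⟦ r ⟧
      m′≤∣r∣ = ≤-trans (<⇒≤ (proj₁ (inCor⇒shift (length-⟪⟫ x) cor))) (ℓ≤length-⟦⟧ r)

    ⟦⟧-last : ∀ c → Valid A B c → ∃ λ P → ⟦ c ⟧ ≡ P ++ ⟪ last c ⟫
    ⟦⟧-last (end x)       _           = [] , refl
    ⟦⟧-last (x ∷⟨ m ⟩ r) (cor , valid) =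
      let P , ⟦r⟧≡ = ⟦⟧-last r valid
      in take (ℓ ∸ m) ⟪ x ⟫ ++ P , (begin
        ⟦ x ∷⟨ m ⟩ r ⟧                              ≡⟨ ⟦⟧-∷ x m r (cor , valid) ⟩
        take (ℓ ∸ m) ⟪ x ⟫ ++ ⟦ r ⟧                 ≡⟨ cong (take (ℓ ∸ m) ⟪ x ⟫ ++_) ⟦r⟧≡ ⟩
        take (ℓ ∸ m) ⟪ x ⟫ ++ (P ++ ⟪ last r ⟫)     ≡⟨ ++-assoc (take (ℓ ∸ m) ⟪ x ⟫) P ⟪ last r ⟫ ⟨
        (take (ℓ ∸ m) ⟪ x ⟫ ++ P) ++ ⟪ last r ⟫     ∎)
      where open ≡-Reasoning

    valid-snocC : ∀ c m s → Valid A B c → InCor ⟪ last c ⟫ ⟪ s ⟫ m → Valid A B (snocC c m s)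
    valid-snocC (end x)        m s _           cor = cor , tt
    valid-snocC (x ∷⟨ m′ ⟩ r) m s (cor′ , valid) cor =
      subst (λ z → InCor ⟪ x ⟫ ⟪ z ⟫ m′) (sym (first-snocC r m s)) cor′ , valid-snocC r m s valid cor

    occurrences-⟦⟧-∷ : ∀ x m r s → Valid A B (x ∷⟨ m ⟩ r) →
      occurrences ⟪ s ⟫ ⟦ x ∷⟨ m ⟩ r ⟧ ≡ occurrencesIn ⟪ s ⟫ (take (ℓ ∸ m) ⟪ x ⟫) ⟪ first r ⟫ ++ occurrences ⟪ s ⟫ ⟦ r ⟧
    occurrences-⟦⟧-∷ x m r s valid = begin
      occurrences ⟪ s ⟫ ⟦ x ∷⟨ m ⟩ r ⟧
        ≡⟨ cong (occurrences ⟪ s ⟫) (⟦⟧-∷ x m r valid) ⟩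
      occurrences ⟪ s ⟫ (take (ℓ ∸ m) ⟪ x ⟫ ++ ⟦ r ⟧)
        ≡⟨ occurrences-++ ⟪ s ⟫ (take (ℓ ∸ m) ⟪ x ⟫) ⟦ r ⟧ (≤-trans (≤-reflexive (length-⟪⟫ s)) (ℓ≤length-⟦⟧ r)) ⟩
      occurrencesIn ⟪ s ⟫ (take (ℓ ∸ m) ⟪ x ⟫) (take (length ⟪ s ⟫) ⟦ r ⟧) ++ occurrences ⟪ s ⟫ ⟦ r ⟧
        ≡⟨ cong (λ V → occurrencesIn ⟪ s ⟫ (take (ℓ ∸ m) ⟪ x ⟫) V ++ occurrences ⟪ s ⟫ ⟦ r ⟧) takeR ⟩
      occurrencesIn ⟪ s ⟫ (take (ℓ ∸ m) ⟪ x ⟫) ⟪ first r ⟫ ++ occurrences ⟪ s ⟫ ⟦ r ⟧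
        ∎
      where
      open ≡-Reasoning
      takeR : take (length ⟪ s ⟫) ⟦ r ⟧ ≡ ⟪ first r ⟫
      takeR = trans (cong (λ k → take k ⟦ r ⟧) (length-⟪⟫ s)) (take-⟦⟧ r)

    occurrences-window-∷ʳ : ∀ x z s m → InCor ⟪ x ⟫ ⟪ z ⟫ m →
      occurrences ⟪ s ⟫ (⟪ x ⟫ ++ drop m ⟪ z ⟫) ≡ occurrencesIn ⟪ s ⟫ (take (ℓ ∸ m) ⟪ x ⟫) ⟪ z ⟫ ∷ʳ occursAt ⟪ s ⟫ ⟪ z ⟫ 0
    occurrences-window-∷ʳ x z s m cor =
      trans (cong (occurrences ⟪ s ⟫) (++-overlap x z m ⟪ z ⟫ cor (take-⟦⟧ (end z))))
            (occurrences-++-whole ⟪ s ⟫ (take (ℓ ∸ m) ⟪ x ⟫) ⟪ z ⟫ (same-length z s))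

    take-determined : ∀ c Y → occurrences ⟪ first c ⟫ Y ≡ occurrences ⟪ first c ⟫ ⟦ c ⟧ → take ℓ Y ≡ ⟪ first c ⟫
    take-determined c Y same = subst (λ k → take k Y ≡ ⟪ first c ⟫) (length-⟪⟫ (first c))
      (does≡true (take (length ⟪ first c ⟫) Y ≟W ⟪ first c ⟫)
        (trans (∷-injectiveˡ same) (dec-true (take (length ⟪ first c ⟫) ⟦ c ⟧ ≟W ⟪ first c ⟫) start)))
      where
      start : take (length ⟪ first c ⟫) ⟦ c ⟧ ≡ ⟪ first c ⟫
      start = subst (λ k → take k ⟦ c ⟧ ≡ ⟪ first c ⟫) (sym (length-⟪⟫ (first c))) (take-⟦⟧ c)

    ⟦⟧-determined : ∀ c → Valid A B c → ∀ Y → length Y ≡ length ⟦ c ⟧ →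
                    (∀ s → occurrences ⟪ s ⟫ Y ≡ occurrences ⟪ s ⟫ ⟦ c ⟧) → Y ≡ ⟦ c ⟧
    ⟦⟧-determined (end x) _ Y ∣Y∣ same =
      trans (sym (take-all ℓ Y (≤-reflexive (trans ∣Y∣ (length-⟪⟫ x))))) (take-determined (end x) Y (same x))
    ⟦⟧-determined c@(x ∷⟨ m ⟩ r) (cor , valid) Y ∣Y∣ same = begin
      Y                              ≡⟨ take++drop≡id u Y ⟨
      take u Y ++ drop u Y           ≡⟨ cong₂ _++_ takeY dropY ⟩
      take u ⟪ x ⟫ ++ ⟦ r ⟧          ≡⟨ ⟦⟧-∷ x m r (cor , valid) ⟨
      ⟦ c ⟧                          ∎
      where
      open ≡-Reasoning
      u : ℕ
      u = ℓ ∸ m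
      ∣take∣ : length (take u ⟪ x ⟫) ≡ u
      ∣take∣ = length-take-≤ u ⟪ x ⟫ (≤-trans (m∸n≤m ℓ m) (≤-reflexive (sym (length-⟪⟫ x))))
      ∣c∣ : length ⟦ c ⟧ ≡ u + length ⟦ r ⟧
      ∣c∣ = trans (cong length (⟦⟧-∷ x m r (cor , valid))) (trans (length-++ (take u ⟪ x ⟫)) (cong (_+ length ⟦ r ⟧) ∣take∣))
      u≤∣Y∣ : u ≤ length Y
      u≤∣Y∣ = ≤-trans (m≤m+n u (length ⟦ r ⟧)) (≤-reflexive (sym (trans ∣Y∣ ∣c∣)))
      ∣dropY∣ : length (drop u Y) ≡ length ⟦ r ⟧
      ∣dropY∣ = trans (length-drop u Y) (trans (cong (_∸ u) (trans ∣Y∣ ∣c∣)) (m+n∸m≡n u (length ⟦ r ⟧)))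
      ℓ≤∣r∣ : ∀ s → length ⟪ s ⟫ ≤ length ⟦ r ⟧
      ℓ≤∣r∣ s = ≤-trans (≤-reflexive (length-⟪⟫ s)) (ℓ≤length-⟦⟧ r)
      sameTail : ∀ s → occurrences ⟪ s ⟫ (drop u Y) ≡ occurrences ⟪ s ⟫ ⟦ r ⟧
      sameTail s = occurrences-++-cancelˡ ⟪ s ⟫ (take u Y) (take u ⟪ x ⟫)
        (trans (length-take-≤ u Y u≤∣Y∣) (sym ∣take∣)) (≤-trans (ℓ≤∣r∣ s) (≤-reflexive (sym ∣dropY∣))) (ℓ≤∣r∣ s)
        (begin
          occurrences ⟪ s ⟫ (take u Y ++ drop u Y)     ≡⟨ cong (occurrences ⟪ s ⟫) (take++drop≡id u Y) ⟩
          occurrences ⟪ s ⟫ Y                          ≡⟨ same s ⟩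
          occurrences ⟪ s ⟫ ⟦ c ⟧                      ≡⟨ cong (occurrences ⟪ s ⟫) (⟦⟧-∷ x m r (cor , valid)) ⟩
          occurrences ⟪ s ⟫ (take u ⟪ x ⟫ ++ ⟦ r ⟧)    ∎)
      dropY : drop u Y ≡ ⟦ r ⟧
      dropY = ⟦⟧-determined r valid (drop u Y) ∣dropY∣ sameTail
      takeY : take u Y ≡ take u ⟪ x ⟫
      takeY = begin
        take u Y               ≡⟨ cong (λ k → take k Y) (m≤n⇒m⊓n≡m (m∸n≤m ℓ m)) ⟨
        take (u ⊓ ℓ) Y         ≡⟨ take-take u ℓ Y ⟨
        take u (take ℓ Y)      ≡⟨ cong (take u) (take-determined c Y (same x)) ⟩
        take u ⟪ x ⟫           ∎

    occurrences-window : ∀ v y w m → occurrences ⟪ v ⟫ (⟪ y ⟫ ++ drop m ⟪ w ⟫) ≡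
                         map (occursAt ⟪ v ⟫ (⟪ y ⟫ ++ drop m ⟪ w ⟫)) (upTo (suc (ℓ ∸ m)))
    occurrences-window v y w m =
      trans (occurrences-upTo ⟪ v ⟫ window) (cong (λ k → map (occursAt ⟪ v ⟫ window) (upTo (suc k))) ∣window∣∸ℓ)
      where
      window : Word
      window = ⟪ y ⟫ ++ drop m ⟪ w ⟫
      ∣window∣∸ℓ : length window ∸ length ⟪ v ⟫ ≡ ℓ ∸ m
      ∣window∣∸ℓ = begin
        length window ∸ length ⟪ v ⟫                            ≡⟨ cong₂ _∸_ (length-++ ⟪ y ⟫) (length-⟪⟫ v) ⟩
        length ⟪ y ⟫ + length (drop m ⟪ w ⟫) ∸ ℓ                ≡⟨ cong (λ k → k + length (drop m ⟪ w ⟫) ∸ ℓ) (length-⟪⟫ y) ⟩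
        ℓ + length (drop m ⟪ w ⟫) ∸ ℓ                           ≡⟨ m+n∸m≡n ℓ _ ⟩
        length (drop m ⟪ w ⟫)                                   ≡⟨ trans (length-drop m ⟪ w ⟫) (cong (_∸ m) (length-⟪⟫ w)) ⟩
        ℓ ∸ m                                                   ∎
        where open ≡-Reasoning

    module Mirror (sameAutocorrelation : ∀ k → InCor A A k ⇔ InCor B B k) where

      shift-bar : ∀ x z i → Shift i ⟪ x ⟫ ⟪ z ⟫ ⇔ Shift i ⟪ bar z ⟫ ⟪ bar x ⟫
      shift-bar a a i = mk⇔ (autocorrelation-shift ∣A∣ ∣B∣ (Equivalence.to ∘ sameAutocorrelation) i)
                            (autocorrelation-shift ∣B∣ ∣A∣ (Equivalence.from ∘ sameAutocorrelation) i)
      shift-bar a b i = mk⇔ id id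
      shift-bar b a i = mk⇔ id id
      shift-bar b b i = ⇔.sym (shift-bar a a i)

      inCor-bar : ∀ x z m → InCor ⟪ x ⟫ ⟪ z ⟫ m → InCor ⟪ bar z ⟫ ⟪ bar x ⟫ m
      inCor-bar x z m cor@(1≤m , _) =
        let m<ℓ , shift = inCor⇒shift (length-⟪⟫ x) cor
        in shift⇒inCor (length-⟪⟫ (bar z)) 1≤m m<ℓ (Equivalence.to (shift-bar x z (ℓ ∸ m)) shift)

      valid-φ : ∀ c → Valid A B c → Valid A B (φ c)
      valid-φ (end x)       _             = tt
      valid-φ (x ∷⟨ m ⟩ r) (cor , valid) = valid-snocC (φ r) m (bar x) (valid-φ r valid)
        (subst (λ y → InCor ⟪ y ⟫ ⟪ bar x ⟫ m) (sym (last-φ r)) (inCor-bar x (first r) m cor))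

      occursAt-mirror : ∀ x z s m d → InCor ⟪ x ⟫ ⟪ z ⟫ m → d ≤ ℓ ∸ m →
                        OccursAt ⟪ s ⟫ (⟪ x ⟫ ++ drop m ⟪ z ⟫) d ⇔
                        OccursAt ⟪ bar s ⟫ (⟪ bar z ⟫ ++ drop m ⟪ bar x ⟫) ((ℓ ∸ m) ∸ d)
      occursAt-mirror x z s m d cor d≤u = begin
        OccursAt ⟪ s ⟫ (⟪ x ⟫ ++ drop m ⟪ z ⟫) d
          ∼⟨ occursAt-window (length-⟪⟫ x) (length-⟪⟫ z) (length-⟪⟫ s) m≤ℓ shift d≤u ⟩
        (Shift d ⟪ x ⟫ ⟪ s ⟫ × Shift (u ∸ d) ⟪ s ⟫ ⟪ z ⟫)
          ∼⟨ shift-bar x s d ×-⇔ shift-bar s z (u ∸ d) ⟩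
        (Shift d ⟪ bar s ⟫ ⟪ bar x ⟫ × Shift (u ∸ d) ⟪ bar z ⟫ ⟪ bar s ⟫)
          ↔⟨ ×-comm _ _ ⟩
        (Shift (u ∸ d) ⟪ bar z ⟫ ⟪ bar s ⟫ × Shift d ⟪ bar s ⟫ ⟪ bar x ⟫)
          ≡⟨ cong (λ i → Shift (u ∸ d) ⟪ bar z ⟫ ⟪ bar s ⟫ × Shift i ⟪ bar s ⟫ ⟪ bar x ⟫) (sym (m∸[m∸n]≡n d≤u)) ⟩
        (Shift (u ∸ d) ⟪ bar z ⟫ ⟪ bar s ⟫ × Shift (u ∸ (u ∸ d)) ⟪ bar s ⟫ ⟪ bar x ⟫)
          ∼⟨ ⇔.sym (occursAt-window (length-⟪⟫ (bar z)) (length-⟪⟫ (bar x)) (length-⟪⟫ (bar s))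
                      m≤ℓ (Equivalence.to (shift-bar x z u) shift) (m∸n≤m u d)) ⟩
        OccursAt ⟪ bar s ⟫ (⟪ bar z ⟫ ++ drop m ⟪ bar x ⟫) (u ∸ d) ∎
        where
        open EquationalReasoning
        u : ℕ
        u = ℓ ∸ m
        m≤ℓ : m ≤ ℓ
        m≤ℓ = <⇒≤ (proj₁ (inCor⇒shift (length-⟪⟫ x) cor))
        shift : Shift u ⟪ x ⟫ ⟪ z ⟫
        shift = proj₂ (inCor⇒shift (length-⟪⟫ x) cor)

      occurrences-window-reverse : ∀ x z s m → InCor ⟪ x ⟫ ⟪ z ⟫ m →
        reverse (occurrences ⟪ bar s ⟫ (⟪ bar z ⟫ ++ drop m ⟪ bar x ⟫)) ≡ occurrences ⟪ s ⟫ (⟪ x ⟫ ++ drop m ⟪ z ⟫)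
      occurrences-window-reverse x z s m cor = begin
        reverse (occurrences ⟪ bar s ⟫ (⟪ bar z ⟫ ++ drop m ⟪ bar x ⟫))
          ≡⟨ cong reverse (occurrences-window (bar s) (bar z) (bar x) m) ⟩
        reverse (map (occursAt ⟪ bar s ⟫ (⟪ bar z ⟫ ++ drop m ⟪ bar x ⟫)) (upTo (suc (ℓ ∸ m))))
          ≡⟨ reverse-map-upTo _ _ (ℓ ∸ m) mirror ⟩
        map (occursAt ⟪ s ⟫ (⟪ x ⟫ ++ drop m ⟪ z ⟫)) (upTo (suc (ℓ ∸ m)))
          ≡⟨ occurrences-window s x z m ⟨
        occurrences ⟪ s ⟫ (⟪ x ⟫ ++ drop m ⟪ z ⟫)
          ∎
        where
        open ≡-Reasoning
        mirror : ∀ i → i ≤ ℓ ∸ m →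
                 occursAt ⟪ bar s ⟫ (⟪ bar z ⟫ ++ drop m ⟪ bar x ⟫) ((ℓ ∸ m) ∸ i) ≡ occursAt ⟪ s ⟫ (⟪ x ⟫ ++ drop m ⟪ z ⟫) i
        mirror i i≤u = does-⇔ (⇔.sym (occursAt-mirror x z s m i cor i≤u)) (_ ≟W ⟪ bar s ⟫) (_ ≟W ⟪ s ⟫)

      occursAt-bar : ∀ s x → occursAt ⟪ bar s ⟫ ⟪ bar x ⟫ 0 ≡ occursAt ⟪ s ⟫ ⟪ x ⟫ 0
      occursAt-bar a a = trans (occursAt-self B) (sym (occursAt-self A))
      occursAt-bar a b = occursAt-comm A B (trans ∣A∣ (sym ∣B∣))
      occursAt-bar b a = occursAt-comm B A (trans ∣B∣ (sym ∣A∣))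
      occursAt-bar b b = trans (occursAt-self A) (sym (occursAt-self B))

      occurrences-φ : ∀ c → Valid A B c → ∀ s → reverse (occurrences ⟪ bar s ⟫ ⟦ φ c ⟧) ≡ occurrences ⟪ s ⟫ ⟦ c ⟧
      occurrences-φ (end x) _ s = begin
        reverse (occurrences ⟪ bar s ⟫ ⟪ bar x ⟫)
          ≡⟨ cong reverse (occurrences-short ⟪ bar s ⟫ ⟪ bar x ⟫ (≤-reflexive (same-length (bar x) (bar s)))) ⟩
        occursAt ⟪ bar s ⟫ ⟪ bar x ⟫ 0 ∷ []
          ≡⟨ cong (_∷ []) (occursAt-bar s x) ⟩
        occursAt ⟪ s ⟫ ⟪ x ⟫ 0 ∷ []
          ≡⟨ occurrences-short ⟪ s ⟫ ⟪ x ⟫ (≤-reflexive (same-length x s)) ⟨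
        occurrences ⟪ s ⟫ ⟪ x ⟫
          ∎
        where open ≡-Reasoning
      occurrences-φ c@(x ∷⟨ m ⟩ r) (cor , valid) s = begin
        reverse (occurrences Sb ⟦ φ c ⟧)
          ≡⟨ cong (reverse ∘ occurrences Sb) ⟦φc⟧≡ ⟩
        reverse (occurrences Sb (P ++ Zb ++ drop m Xb))
          ≡⟨ cong reverse (occurrences-++-++ Sb P Zb (drop m Xb) (same-length (bar z) (bar s))) ⟩
        reverse (occurrencesIn Sb P Zb ++ occurrences Sb (Zb ++ drop m Xb))
          ≡⟨ reverse-++ (occurrencesIn Sb P Zb) (occurrences Sb (Zb ++ drop m Xb)) ⟩
        reverse (occurrences Sb (Zb ++ drop m Xb)) ++ earlier
          ≡⟨ cong (_++ earlier) (occurrences-window-reverse x z s m cor) ⟩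
        occurrences S (X ++ drop m Z) ++ earlier
          ≡⟨ cong (_++ earlier) (occurrences-window-∷ʳ x z s m cor) ⟩
        (occurrencesIn S (take (ℓ ∸ m) X) Z ∷ʳ occursAt S Z 0) ++ earlier
          ≡⟨ ∷ʳ-++ (occurrencesIn S (take (ℓ ∸ m) X) Z) (occursAt S Z 0) earlier ⟩
        occurrencesIn S (take (ℓ ∸ m) X) Z ++ occursAt S Z 0 ∷ earlier
          ≡⟨ cong (occurrencesIn S (take (ℓ ∸ m) X) Z ++_) tail≡ ⟩
        occurrencesIn S (take (ℓ ∸ m) X) Z ++ occurrences S ⟦ r ⟧
          ≡⟨ occurrences-⟦⟧-∷ x m r s (cor , valid) ⟨
        occurrences S ⟦ c ⟧
          ∎
        where
        open ≡-Reasoning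
        z : Sym
        z = first r
        S Sb X Xb Z Zb : Word
        S = ⟪ s ⟫
        Sb = ⟪ bar s ⟫
        X = ⟪ x ⟫
        Xb = ⟪ bar x ⟫
        Z = ⟪ z ⟫
        Zb = ⟪ bar z ⟫
        P : Word
        P = proj₁ (⟦⟧-last (φ r) (valid-φ r valid))
        ⟦φr⟧≡ : ⟦ φ r ⟧ ≡ P ++ Zb
        ⟦φr⟧≡ = trans (proj₂ (⟦⟧-last (φ r) (valid-φ r valid))) (cong (λ y → P ++ ⟪ y ⟫) (last-φ r))
        ⟦φc⟧≡ : ⟦ φ c ⟧ ≡ P ++ Zb ++ drop m Xb
        ⟦φc⟧≡ = begin
          ⟦ φ c ⟧                  ≡⟨ ⟦⟧-snocC (φ r) m (bar x) (valid-φ r valid) ⟩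
          ⟦ φ r ⟧ ++ drop m Xb     ≡⟨ cong (_++ drop m Xb) ⟦φr⟧≡ ⟩
          (P ++ Zb) ++ drop m Xb   ≡⟨ ++-assoc P Zb (drop m Xb) ⟩
          P ++ Zb ++ drop m Xb     ∎
        earlier : List Bool
        earlier = reverse (occurrencesIn Sb P Zb)
        tail≡ : occursAt S Z 0 ∷ earlier ≡ occurrences S ⟦ r ⟧
        tail≡ = begin
          occursAt S Z 0 ∷ earlier
            ≡⟨ cong (_∷ earlier) (occursAt-bar s z) ⟨
          occursAt Sb Zb 0 ∷ earlier
            ≡⟨ reverse-++ (occurrencesIn Sb P Zb) (occursAt Sb Zb 0 ∷ []) ⟨
          reverse (occurrencesIn Sb P Zb ∷ʳ occursAt Sb Zb 0)
            ≡⟨ cong reverse (occurrences-++-whole Sb P Zb (same-length (bar z) (bar s))) ⟨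
          reverse (occurrences Sb (P ++ Zb))
            ≡⟨ cong (reverse ∘ occurrences Sb) ⟦φr⟧≡ ⟨
          reverse (occurrences Sb ⟦ φ r ⟧)
            ≡⟨ occurrences-φ r valid s ⟩
          occurrences S ⟦ r ⟧
            ∎

      length-φ : ∀ c → Valid A B c → length ⟦ φ c ⟧ ≡ length ⟦ c ⟧
      length-φ c valid = ∸-cancelʳ-≡ (ℓ≤length-⟦⟧ (φ c)) (ℓ≤length-⟦⟧ c) (suc-injective (begin
        suc (length ⟦ φ c ⟧ ∸ ℓ)                      ≡⟨ cong (λ k → suc (length ⟦ φ c ⟧ ∸ k)) ∣B∣ ⟨
        suc (length ⟦ φ c ⟧ ∸ length B)               ≡⟨ length-occurrences B ⟦ φ c ⟧ ⟨
        length (occurrences B ⟦ φ c ⟧)                ≡⟨ length-reverse (occurrences B ⟦ φ c ⟧) ⟨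
        length (reverse (occurrences B ⟦ φ c ⟧))      ≡⟨ cong length (occurrences-φ c valid a) ⟩
        length (occurrences A ⟦ c ⟧)                  ≡⟨ length-occurrences A ⟦ c ⟧ ⟩
        suc (length ⟦ c ⟧ ∸ length A)                 ≡⟨ cong (λ k → suc (length ⟦ c ⟧ ∸ k)) ∣A∣ ⟩
        suc (length ⟦ c ⟧ ∸ ℓ)                        ∎))
        where open ≡-Reasoning

      ⟦φ⟧-cong : ∀ c c′ → Valid A B c → Valid A B c′ → ⟦ c ⟧ ≡ ⟦ c′ ⟧ → ⟦ φ c ⟧ ≡ ⟦ φ c′ ⟧
      ⟦φ⟧-cong c c′ valid valid′ ⟦c⟧≡⟦c′⟧ =
        ⟦⟧-determined (φ c′) (valid-φ c′ valid′) ⟦ φ c ⟧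
          (trans (length-φ c valid) (trans (cong length ⟦c⟧≡⟦c′⟧) (sym (length-φ c′ valid′))))
          (λ { a → same-bar b ; b → same-bar a })
        where
        same-bar : ∀ t → occurrences ⟪ bar t ⟫ ⟦ φ c ⟧ ≡ occurrences ⟪ bar t ⟫ ⟦ φ c′ ⟧
        same-bar t = reverse-injective (begin
          reverse (occurrences ⟪ bar t ⟫ ⟦ φ c ⟧)    ≡⟨ occurrences-φ c valid t ⟩
          occurrences ⟪ t ⟫ ⟦ c ⟧                    ≡⟨ cong (occurrences ⟪ t ⟫) ⟦c⟧≡⟦c′⟧ ⟩
          occurrences ⟪ t ⟫ ⟦ c′ ⟧                   ≡⟨ occurrences-φ c′ valid′ t ⟨
          reverse (occurrences ⟪ bar t ⟫ ⟦ φ c′ ⟧)   ∎)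
          where open ≡-Reasoning

      N-φ : ∀ c → Valid A B c → ∀ s → N ⟪ s ⟫ ⟦ c ⟧ ≡ N ⟪ bar s ⟫ ⟦ φ c ⟧
      N-φ c valid s = begin
        N ⟪ s ⟫ ⟦ c ⟧                                    ≡⟨ N≡count-occurrences ⟪ s ⟫ ⟦ c ⟧ ⟩
        count (occurrences ⟪ s ⟫ ⟦ c ⟧)                  ≡⟨ cong count (occurrences-φ c valid s) ⟨
        count (reverse (occurrences ⟪ bar s ⟫ ⟦ φ c ⟧))  ≡⟨ count-reverse (occurrences ⟪ bar s ⟫ ⟦ φ c ⟧) ⟩
        count (occurrences ⟪ bar s ⟫ ⟦ φ c ⟧)            ≡⟨ N≡count-occurrences ⟪ bar s ⟫ ⟦ φ c ⟧ ⟨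
        N ⟪ bar s ⟫ ⟦ φ c ⟧                              ∎
        where open ≡-Reasoning

proposition1 : (ℓ : ℕ) (A B : Word) → length A ≡ ℓ → length B ≡ ℓ →
    (∀ k → InCor A A k ⇔ InCor B B k) →
    ((c : Chain) → Valid A B c → Valid A B (φ c))
    × ((c c' : Chain) → Valid A B c → Valid A B c' → word A B c ≡ word A B c' →
         word A B (φ c) ≡ word A B (φ c'))
    × ((c : Chain) → Valid A B c → word A B (φ (φ c)) ≡ word A B c)
    × ((c : Chain) → Valid A B c → length (word A B (φ c)) ≡ length (word A B c))
    × ((c : Chain) → Valid A B c →
         (N A (word A B c) ≡ N B (word A B (φ c))) × (N B (word A B c) ≡ N A (word A B (φ c))))
proposition1 ℓ A B ∣A∣ ∣B∣ sameAutocorrelation =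
  valid-φ , ⟦φ⟧-cong , (λ c _ → cong (word A B) (φ-involutive c)) , length-φ , (λ c valid → N-φ c valid a , N-φ c valid b)
  where
  open WordsOfLength ℓ
  open Overlaps A B ∣A∣ ∣B∣
  open Mirror sameAutocorrelation
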